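{- For all $k\in\mathbb{N}$ and $t\in T$, the supertile $\sigma^k(t)$ contains an all-zero tile ($\triangle(0,0,0)$ or $\triangledown(0,0,0)$) if and only if $t$ is an all-zero tile.
   Context: Let $p$ be an odd prime and $\mathbb{F}_p$ the field with $p$ elements. A tile is a unit equilateral triangle of the standard triangular lattice, oriented upward or downward, whose corners are decorated with elements of $\mathbb{F}_p$. $\triangle(x,y,z)$ is the upward tile with bottom-left, bottom-right, top corners $x,y,z$; $\triangledown(x,y,z)$ the downward tile with top-right, top-left, bottom corners $x,y,z$; $T$ is the set of all such tiles. The substitution $\sigma$ inflates a tile by factor $2$ and replaces it by four unit tiles: $\sigma(\triangle(x,y,z))$ consists of bottom-left $\triangle(x,x+y,x+z)$, bottom-right $\triangle(x+y,y,y+z)$, top $\triangle(x+z,y+z,z)$ and central $\triangledown(y+z,x+z,x+y)$; $\sigma(\triangledown(x,y,z))$ consists of top-right $\triangledown(x,x+y,x+z)$, top-left $\triangledown(x+y,y,y+z)$, bottom $\triangledown(x+z,y+z,z)$ and central $\triangle(y+z,x+z,x+y)$. $\sigma$ acts on patches tile by tile; $\sigma^k(t)$ is a triangle of side $2^k$ made of $4^k$ decorated unit tiles. -}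

module Defs where

open import Data.Nat using (ℕ; zero; suc; NonZero)
import Data.Nat as ℕ
open import Data.Nat.DivMod using (_mod_)
open import Data.Fin using (Fin; toℕ)
open import Data.List using (List; []; _∷_; concatMap)

𝔽 : ℕ → Set
𝔽 p = Fin p

module _ (p : ℕ) .{{_ : NonZero p}} where

  infixl 6 _⊕_
  _⊕_ : 𝔽 p → 𝔽 p → 𝔽 p
  x ⊕ y = (toℕ x ℕ.+ toℕ y) mod p

  𝟘 : 𝔽 p
  𝟘 = 0 mod p

  -- △ x y z : upward tile, corners bottom-left x, bottom-right y, top z.
  -- ▽ x y z : downward tile, corners top-right x, top-left y, bottom z.
  data Tile : Set where
    △ : 𝔽 p → 𝔽 p → 𝔽 p → Tile
    ▽ : 𝔽 p → 𝔽 p → 𝔽 p → Tile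

  -- The four tiles of σ(t) (positions forgotten; only the tiles are kept).
  σ₁ : Tile → List Tile
  σ₁ (△ x y z) = △ x (x ⊕ y) (x ⊕ z) ∷ △ (x ⊕ y) y (y ⊕ z) ∷ △ (x ⊕ z) (y ⊕ z) z
               ∷ ▽ (y ⊕ z) (x ⊕ z) (x ⊕ y) ∷ []
  σ₁ (▽ x y z) = ▽ x (x ⊕ y) (x ⊕ z) ∷ ▽ (x ⊕ y) y (y ⊕ z) ∷ ▽ (x ⊕ z) (y ⊕ z) z
               ∷ △ (y ⊕ z) (x ⊕ z) (x ⊕ y) ∷ []

  σ^ : ℕ → Tile → List Tile
  σ^ zero t = t ∷ []
  σ^ (suc k) t = concatMap σ₁ (σ^ k t)

  data AllZero : Tile → Set where
    up0   : AllZero (△ 𝟘 𝟘 𝟘)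
    down0 : AllZero (▽ 𝟘 𝟘 𝟘)

-- An all-zero tile has an all-zero corner child, so all-zero tiles persist in every
-- supertile. Conversely an all-zero child of σ(t) forces t to be all-zero: a corner child shares a
-- corner x of t and has the other corners x + y, x + z, while the central child has the
-- pairwise sums y + z, x + z, x + y, whose vanishing gives 2x = 0 and hence x = 0 since p
-- is odd.
module Submission where

open import Defs
open import Data.Nat using (ℕ; NonZero; zero; suc; _+_; _*_; _%_; >-nonZero⁻¹)
open import Data.Nat.Properties using (+-comm; ≤-antisym)
open import Data.Nat.DivMod using (_mod_; m<n⇒m%n≡m)
open import Data.Nat.Divisibility using (_∣_; ∣⇒≤; ∣m∣n⇒∣m+n; ∣m+n∣m⇒∣n; n∣m⇒m%n≡0; m%n≡0⇒n∣m)
open import Data.Nat.Primality using (Prime; euclidsLemma; prime⇒nonTrivial)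
open import Data.Nat.Tactic.RingSolver using (solve-∀)
open import Data.Nat.Base using (nonTrivial⇒n>1)
open import Data.Fin using (toℕ)
open import Data.Fin.Properties using (toℕ-fromℕ<; toℕ-injective; toℕ<n)
open import Data.Product using (∃; _×_; _,_)
open import Data.Sum using (inj₁; inj₂)
open import Data.Empty using (⊥-elim)
open import Data.List.Relation.Unary.Any using (here; there)
open import Data.List.Membership.Propositional using (_∈_; find; lose)
open import Data.List.Membership.Propositional.Properties using (∈-concatMap⁺; ∈-concatMap⁻)
open import Relation.Binary.PropositionalEquality using (_≡_; _≢_; refl; sym; trans; cong; subst)
open import Function.Bundles using (_⇔_; mk⇔)

prime∣2⇒≡2 : ∀ {q} → Prime q → q ∣ 2 → q ≡ 2
prime∣2⇒≡2 {q} q-prime q∣2 =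
  ≤-antisym (∣⇒≤ q∣2) (nonTrivial⇒n>1 q {{prime⇒nonTrivial q-prime}})

prime≢2-∣-pairwise-sums : ∀ {q a b c} → Prime q → q ≢ 2 →
  q ∣ a + b → q ∣ a + c → q ∣ b + c → q ∣ a
prime≢2-∣-pairwise-sums {q} {a} {b} {c} q-prime q≢2 q∣a+b q∣a+c q∣b+c
  with euclidsLemma 2 a q-prime q∣2a
  where
    regroup : ∀ a b c → (a + b) + (a + c) ≡ (b + c) + 2 * a
    regroup = solve-∀
    q∣2a : q ∣ 2 * a
    q∣2a = ∣m+n∣m⇒∣n (subst (q ∣_) (regroup a b c) (∣m∣n⇒∣m+n q∣a+b q∣a+c)) q∣b+c
... | inj₁ q∣2 = ⊥-elim (q≢2 (prime∣2⇒≡2 q-prime q∣2))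
... | inj₂ q∣a = q∣a

module _ (p : ℕ) .{{_ : NonZero p}} where

  σ^-reflects : (P : Tile p → Set) → (∀ {s t} → s ∈ σ₁ p t → P s → P t) →
    ∀ k {s t} → s ∈ σ^ p k t → P s → P t
  σ^-reflects P σ₁-reflects zero (here refl) Ps = Ps
  σ^-reflects P σ₁-reflects (suc k) {t = t} s∈ Ps =
    let u , u∈ , s∈σ₁u = find (∈-concatMap⁻ (σ₁ p) {xs = σ^ p k t} s∈)
    in σ^-reflects P σ₁-reflects k u∈ (σ₁-reflects s∈σ₁u Ps)

  σ^-preserves : (P : Tile p → Set) → (∀ {t} → P t → ∃ λ s → s ∈ σ₁ p t × P s) →
    ∀ k {t} → P t → ∃ λ s → s ∈ σ^ p k t × P s
  σ^-preserves P σ₁-preserves zero Pt = _ , here refl , Pt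
  σ^-preserves P σ₁-preserves (suc k) Pt =
    let u , u∈ , Pu = σ^-preserves P σ₁-preserves k Pt
        s , s∈σ₁u , Ps = σ₁-preserves Pu
    in s , ∈-concatMap⁺ (σ₁ p) (lose u∈ s∈σ₁u) , Ps

  infixl 6 _+ₚ_
  _+ₚ_ : 𝔽 p → 𝔽 p → 𝔽 p
  _+ₚ_ = _⊕_ p

  0ₚ : 𝔽 p
  0ₚ = 𝟘 p

  toℕ-0ₚ : toℕ 0ₚ ≡ 0
  toℕ-0ₚ = trans (toℕ-fromℕ< _) (m<n⇒m%n≡m (>-nonZero⁻¹ p))

  toℕ-+ₚ : ∀ x y → toℕ (x +ₚ y) ≡ (toℕ x + toℕ y) % p
  toℕ-+ₚ x y = toℕ-fromℕ< _

  +ₚ-comm : ∀ x y → x +ₚ y ≡ y +ₚ x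
  +ₚ-comm x y = toℕ-injective (trans (toℕ-+ₚ x y)
    (trans (cong (_% p) (+-comm (toℕ x) (toℕ y))) (sym (toℕ-+ₚ y x))))

  0ₚ+ₚ0ₚ : 0ₚ +ₚ 0ₚ ≡ 0ₚ
  0ₚ+ₚ0ₚ = cong (λ n → (n + n) mod p) toℕ-0ₚ

  ≡0ₚ⇒∣ : ∀ {x} → x ≡ 0ₚ → p ∣ toℕ x
  ≡0ₚ⇒∣ refl = m%n≡0⇒n∣m _ p (trans (m<n⇒m%n≡m (toℕ<n 0ₚ)) toℕ-0ₚ)

  ∣⇒≡0ₚ : ∀ {x} → p ∣ toℕ x → x ≡ 0ₚ
  ∣⇒≡0ₚ {x} p∣x = toℕ-injective
    (trans (sym (m<n⇒m%n≡m (toℕ<n x))) (trans (n∣m⇒m%n≡0 _ p p∣x) (sym toℕ-0ₚ)))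

  +ₚ≡0ₚ⇒∣ : ∀ x y → x +ₚ y ≡ 0ₚ → p ∣ toℕ x + toℕ y
  +ₚ≡0ₚ⇒∣ x y x+y≡0 = m%n≡0⇒n∣m _ p (trans (sym (toℕ-+ₚ x y)) (trans (cong toℕ x+y≡0) toℕ-0ₚ))

  ≡0ₚ-cancelˡ : ∀ {x y} → x ≡ 0ₚ → x +ₚ y ≡ 0ₚ → y ≡ 0ₚ
  ≡0ₚ-cancelˡ {x} {y} x≡0 x+y≡0 = ∣⇒≡0ₚ (∣m+n∣m⇒∣n (+ₚ≡0ₚ⇒∣ x y x+y≡0) (≡0ₚ⇒∣ x≡0))

  ≡0ₚ-cancelʳ : ∀ {x y} → y ≡ 0ₚ → x +ₚ y ≡ 0ₚ → x ≡ 0ₚ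
  ≡0ₚ-cancelʳ {x} {y} y≡0 x+y≡0 = ≡0ₚ-cancelˡ y≡0 (trans (+ₚ-comm y x) x+y≡0)

  Zero³ : 𝔽 p → 𝔽 p → 𝔽 p → Set
  Zero³ x y z = x ≡ 0ₚ × y ≡ 0ₚ × z ≡ 0ₚ

  ZeroCorners : Tile p → Set
  ZeroCorners (△ x y z) = Zero³ x y z
  ZeroCorners (▽ x y z) = Zero³ x y z

  allZero⇒zeroCorners : ∀ {t} → AllZero p t → ZeroCorners t
  allZero⇒zeroCorners up0   = refl , refl , refl
  allZero⇒zeroCorners down0 = refl , refl , refl

  zeroCorners⇒allZero : ∀ t → ZeroCorners t → AllZero p t
  zeroCorners⇒allZero (△ _ _ _) (refl , refl , refl) = up0
  zeroCorners⇒allZero (▽ _ _ _) (refl , refl , refl) = down0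

  σ₁-preserves-allZero : ∀ {t} → AllZero p t → ∃ λ s → s ∈ σ₁ p t × AllZero p s
  σ₁-preserves-allZero up0   = _ , here refl , zeroCorners⇒allZero _ (refl , 0ₚ+ₚ0ₚ , 0ₚ+ₚ0ₚ)
  σ₁-preserves-allZero down0 = _ , here refl , zeroCorners⇒allZero _ (refl , 0ₚ+ₚ0ₚ , 0ₚ+ₚ0ₚ)

  module _ {x y z : 𝔽 p} where

    corner-childˣ : Zero³ x (x +ₚ y) (x +ₚ z) → Zero³ x y z
    corner-childˣ (x≡0 , x+y≡0 , x+z≡0) =
      x≡0 , ≡0ₚ-cancelˡ x≡0 x+y≡0 , ≡0ₚ-cancelˡ x≡0 x+z≡0

    corner-childʸ : Zero³ (x +ₚ y) y (y +ₚ z) → Zero³ x y z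
    corner-childʸ (x+y≡0 , y≡0 , y+z≡0) =
      ≡0ₚ-cancelʳ y≡0 x+y≡0 , y≡0 , ≡0ₚ-cancelˡ y≡0 y+z≡0

    corner-childᶻ : Zero³ (x +ₚ z) (y +ₚ z) z → Zero³ x y z
    corner-childᶻ (x+z≡0 , y+z≡0 , z≡0) =
      ≡0ₚ-cancelʳ z≡0 x+z≡0 , ≡0ₚ-cancelʳ z≡0 y+z≡0 , z≡0

  module _ (p-prime : Prime p) (p≢2 : p ≢ 2) where

    pairwise-sums≡0ₚ : ∀ {x y z} → x +ₚ y ≡ 0ₚ → x +ₚ z ≡ 0ₚ → y +ₚ z ≡ 0ₚ → x ≡ 0ₚ
    pairwise-sums≡0ₚ {x} {y} {z} x+y≡0 x+z≡0 y+z≡0 = ∣⇒≡0ₚ (prime≢2-∣-pairwise-sums p-prime p≢2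
      (+ₚ≡0ₚ⇒∣ x y x+y≡0) (+ₚ≡0ₚ⇒∣ x z x+z≡0) (+ₚ≡0ₚ⇒∣ y z y+z≡0))

    central-child : ∀ {x y z} → Zero³ (y +ₚ z) (x +ₚ z) (x +ₚ y) → Zero³ x y z
    central-child {x} {y} {z} (y+z≡0 , x+z≡0 , x+y≡0) =
        pairwise-sums≡0ₚ x+y≡0 x+z≡0 y+z≡0
      , pairwise-sums≡0ₚ (trans (+ₚ-comm y x) x+y≡0) y+z≡0 x+z≡0
      , pairwise-sums≡0ₚ (trans (+ₚ-comm z x) x+z≡0) (trans (+ₚ-comm z y) y+z≡0) x+y≡0

    σ₁-reflects-zeroCorners : ∀ {s t} → s ∈ σ₁ p t → ZeroCorners s → ZeroCorners t
    σ₁-reflects-zeroCorners {t = △ _ _ _} (here refl)                         = corner-childˣ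
    σ₁-reflects-zeroCorners {t = △ _ _ _} (there (here refl))                 = corner-childʸ
    σ₁-reflects-zeroCorners {t = △ _ _ _} (there (there (here refl)))         = corner-childᶻ
    σ₁-reflects-zeroCorners {t = △ _ _ _} (there (there (there (here refl)))) = central-child
    σ₁-reflects-zeroCorners {t = ▽ _ _ _} (here refl)                         = corner-childˣ
    σ₁-reflects-zeroCorners {t = ▽ _ _ _} (there (here refl))                 = corner-childʸ
    σ₁-reflects-zeroCorners {t = ▽ _ _ _} (there (there (here refl)))         = corner-childᶻ
    σ₁-reflects-zeroCorners {t = ▽ _ _ _} (there (there (there (here refl)))) = central-child

    σ₁-reflects-allZero : ∀ {s t} → s ∈ σ₁ p t → AllZero p s → AllZero p t
    σ₁-reflects-allZero {t = t} s∈ s₀ =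
      zeroCorners⇒allZero t (σ₁-reflects-zeroCorners s∈ (allZero⇒zeroCorners s₀))

mainTheorem8 : (p : ℕ) .{{_ : NonZero p}} → Prime p → p ≢ 2 →
    (k : ℕ) (t : Tile p) →
    (∃ λ s → s ∈ σ^ p k t × AllZero p s) ⇔ AllZero p t
mainTheorem8 p p-prime p≢2 k t = mk⇔
  (λ (s , s∈ , s₀) → σ^-reflects p (AllZero p) (σ₁-reflects-allZero p p-prime p≢2) k s∈ s₀)
  (σ^-preserves p (AllZero p) (σ₁-preserves-allZero p) k)
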